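{- Let $\delta=(E,\emptyset,\mapsto)$ be the DES with $E=\{a,b,c,d,e\}$, no conflicts, and bundles $\{x,y\}\mapsto e$ for all distinct $x,y\in\{a,b,c,d\}$. There is no SES $\sigma=(E,\#',\to,\mathrm{Drop})$ with the same event set $E$ such that $\mathrm{Traces}(\delta)=\mathrm{Traces}(\sigma)$.
   Context: A DES is $(E,\#,\mapsto)$ with $\#\subseteq E^2$ irreflexive symmetric and $\mapsto\subseteq\mathcal P(E)\times E$ (bundles); a trace is a sequence $e_1\cdots e_n$ of pairwise distinct, pairwise non-conflicting events of $E$ such that each bundle $X\mapsto e_i$ meets $\{e_1,\dots,e_{i-1}\}$. An SES is $\sigma=(E,\#,\to,\mathrm{Drop})$ with $\#\subseteq E^2$ irreflexive symmetric, $\to\subseteq E^2$, $\mathrm{Drop}\subseteq E^3$ with $(d,c,t)\in\mathrm{Drop}$ implying $c\to t$ and $d\notin\{c,t\}$. With $\mathrm{ic}(e)=\{e'\mid e'\to e\}$ and $\mathrm{dc}(H,e)=\{e'\mid\exists d\in H.(d,e',e)\in\mathrm{Drop}\}$, a trace of $\sigma$ is a sequence $e_1\cdots e_n$ of pairwise distinct, pairwise non-conflicting events with $\mathrm{ic}(e_i)\setminus\mathrm{dc}(\{e_1,\dots,e_{i-1}\},e_i)\subseteq\{e_1,\dots,e_{i-1}\}$ for all $i$. -}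

module Defs where

open import Level using (0ℓ; Lift)
import Level
open import Data.Empty using (⊥)
open import Data.Product using (Σ; ∃; _×_; _,_)
open import Data.Sum using (_⊎_)
open import Data.List using (List; []; _∷_; _++_)
open import Data.List.Membership.Propositional using (_∈_)
open import Data.List.Relation.Unary.Unique.Propositional using (Unique)
open import Data.List.Relation.Unary.AllPairs using (AllPairs)
open import Relation.Nullary using (¬_)
open import Relation.Unary using (Pred)
open import Relation.Binary.PropositionalEquality using (_≡_)

Subset : Set → Set₁
Subset E = Pred E 0ℓ

record DES (E : Set) : Set₂ where
  field
    _#_      : E → E → Set
    #-irrefl : ∀ x → ¬ (x # x)
    #-sym    : ∀ x y → x # y → y # x
    _↦_      : Subset E → E → Set₁

record SES (E : Set) : Set₁ where
  field
    _#_      : E → E → Set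
    #-irrefl : ∀ x → ¬ (x # x)
    #-sym    : ∀ x y → x # y → y # x
    _⟶_      : E → E → Set
    Drop     : E → E → E → Set
    Drop⇒⟶   : ∀ d c t → Drop d c t → c ⟶ t
    Drop-d≢c : ∀ d c t → Drop d c t → ¬ (d ≡ c)
    Drop-d≢t : ∀ d c t → Drop d c t → ¬ (d ≡ t)

WellFormedSeq : {E : Set} → (E → E → Set) → (List E → E → Set₁) → List E → Set₁
WellFormedSeq {E} _#_ Cond t =
  Unique t × AllPairs (λ x y → ¬ (x # y)) t ×
  (∀ (p : List E) (x : E) (s : List E) → t ≡ p ++ x ∷ s → Cond p x)

DESTrace : {E : Set} → DES E → List E → Set₁
DESTrace {E} δ = WellFormedSeq _#_ (λ p x → ∀ (X : Subset E) → X ↦ x → ∃ λ z → X z × z ∈ p)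
  where open DES δ

ic : {E : Set} → SES E → E → Subset E
ic σ x = λ e' → e' ⟶ x
  where open SES σ

dc : {E : Set} → SES E → Subset E → E → Subset E
dc σ H x = λ e' → ∃ λ d → H d × Drop d e' x
  where open SES σ

SESTrace : {E : Set} → SES E → List E → Set₁
SESTrace {E} σ = WellFormedSeq _#_
  (λ p x → Lift1 (∀ z → ic σ x z → ¬ dc σ (λ y → y ∈ p) x z → z ∈ p))
  where
    open SES σ
    Lift1 : Set → Set₁
    Lift1 A = Lift (Level.suc 0ℓ) A

SameTraces : {E : Set} → DES E → SES E → Set₁
SameTraces {E} δ σ = ∀ (t : List E) → (DESTrace δ t → SESTrace σ t) × (SESTrace σ t → DESTrace δ t)

data Ev : Set where
  a b c d e : Ev

Lower : Ev → Set
Lower x = (x ≡ a) ⊎ (x ≡ b) ⊎ (x ≡ c) ⊎ (x ≡ d)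

δBundle : Subset Ev → Ev → Set
δBundle X y = (y ≡ e) × Σ Ev λ x → Σ Ev λ x' →
  Lower x × Lower x' × ¬ (x ≡ x') × (∀ z → (X z → (z ≡ x ⊎ z ≡ x')) × ((z ≡ x ⊎ z ≡ x') → X z))

δ : DES Ev
δ = record
  { _#_ = λ _ _ → ⊥
  ; #-irrefl = λ _ ()
  ; #-sym = λ _ _ ()
  ; _↦_ = λ X y → Lift (Level.suc 0ℓ) (δBundle X y)
  }

-- Split the lower events {a,b,c,d} into a pair {u,v} and its complement {x,y}.  In δ the
-- sequence u v e is not a trace (it misses the bundle {x,y}) while u v x e and u v y e are.
-- In an SES with the same traces, e therefore has a cause z outside {u,v} that neither u nor v
-- drops, and the traces u v x e, u v y e force x to drop z unless z = x, and y unless z = y.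
-- Two different pairs cannot share such a cause: some event of the first pair lies in the
-- complement of the second, so it would have to drop the cause, which the first pair forbids.
-- Hence the six pairs would have six distinct causes among only five events.
module Submission where

open import Defs
open import Data.Empty using (⊥-elim)
open import Data.Fin using (Fin; zero; suc)
open import Data.Fin.Properties using (<⇒notInjective; sequence; inj⇒≟; all?)
import Data.Fin.Properties as Fin
open import Data.List using (List; []; _∷_; _++_; _∷ʳ_)
open import Data.List.Membership.Propositional using (_∈_; _∉_; find)
open import Data.List.Membership.Propositional.Properties using (∈-++⁻)
open import Data.List.Relation.Binary.Permutation.Propositional using (_↭_; ↭-prep; ↭-swap; ↭-refl)
open import Data.List.Relation.Binary.Permutation.Propositional.Properties using (∈-resp-↭)
import Data.List.Membership.DecPropositional as DecMembership
open import Data.List.Relation.Binary.Subset.Propositional using (_⊆_)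
import Data.List.Relation.Binary.Subset.DecPropositional as DecSubset
open import Data.List.Relation.Unary.All as All using (All; []; _∷_)
open import Data.List.Relation.Unary.AllPairs using (AllPairs; []; _∷_)
open import Data.List.Relation.Unary.Any using (Any; here; there; any?)
open import Data.List.Relation.Unary.Any.Properties using (singleton⁻)
open import Data.List.Relation.Unary.Unique.Propositional using (Unique)
open import Data.List.Relation.Unary.Unique.DecPropositional using (unique?)
open import Data.Nat.Properties using (n<1+n)
open import Data.Product using (Σ; ∃; _×_; _,_; proj₁; proj₂)
open import Data.Sum using (_⊎_; inj₁; inj₂)
import Data.Sum as Sum
open import Effect.Monad using (RawMonad)
open import Function using (_∘_; id; Injective)
open import Function.Bundles using (mk↣)
open import Level using (Lift; lift; lower)
open import Relation.Binary.Definitions using (DecidableEquality)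
open import Relation.Binary.PropositionalEquality
  using (_≡_; _≢_; refl; sym; trans; cong; subst; module ≡-Reasoning)
open import Relation.Nullary using (¬_; Dec)
open import Relation.Nullary.Decidable using (decidable-stable; toWitness; _×-dec_; _⊎-dec_)
open import Relation.Nullary.Negation using (¬¬-Monad)

∈-∷ʳ⁻ : ∀ {A : Set} (p : List A) {x z} → z ∈ p ∷ʳ x → z ∈ p ⊎ z ≡ x
∈-∷ʳ⁻ p = Sum.map₂ singleton⁻ ∘ ∈-++⁻ p

module _ {E : Set} (σ : SES E) where
  open SES σ

  Enabled : List E → E → Set
  Enabled p x = ∀ z → ic σ x z → ¬ dc σ (_∈ p) x z → z ∈ p

  PendingCause : List E → E → E → Set
  PendingCause p x z = ic σ x z × ¬ dc σ (_∈ p) x z × z ∉ p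

  enabled-in-trace : ∀ p x s → SESTrace σ (p ++ x ∷ s) → Enabled p x
  enabled-in-trace p x s (_ , _ , enabled) = lower (enabled p x s refl)

  enabled-if-nothing-pending : DecidableEquality E → ∀ {p x} →
                               (∀ z → ¬ PendingCause p x z) → Enabled p x
  enabled-if-nothing-pending _≟_ {p} nothing-pending z z⟶x undropped =
    decidable-stable (DecMembership._∈?_ _≟_ z p)
      (λ z∉p → nothing-pending z (z⟶x , undropped , z∉p))

  undropped-after-∷ʳ : ∀ {p w x z} → ¬ dc σ (_∈ p) x z → ¬ Drop w z x → ¬ dc σ (_∈ p ∷ʳ w) x z
  undropped-after-∷ʳ {p} undropped ¬drop (y , y∈p∷ʳw , drop) with ∈-∷ʳ⁻ p y∈p∷ʳw
  ... | inj₁ y∈p  = undropped (y , y∈p , drop)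
  ... | inj₂ refl = ¬drop drop

  pending-resolved : ∀ {p w x z} → PendingCause p x z → Enabled (p ∷ʳ w) x →
                     ¬ Drop w z x → z ≡ w
  pending-resolved {p} {z = z} (z⟶x , undropped , z∉p) enabled ¬drop
    with ∈-∷ʳ⁻ p (enabled z z⟶x (undropped-after-∷ʳ undropped ¬drop))
  ... | inj₁ z∈p = ⊥-elim (z∉p z∈p)
  ... | inj₂ z≡w = z≡w

  skip-unneeded : ∀ {u v w x} → SESTrace σ (u ∷ v ∷ w ∷ x ∷ []) →
                  Enabled (u ∷ v ∷ []) x → SESTrace σ (u ∷ v ∷ x ∷ [])
  skip-unneeded {u} {v} {x = x}
    ( (u≢v ∷ _ ∷ u≢x ∷ []) ∷ (_ ∷ v≢x ∷ []) ∷ _ ∷ [] ∷ []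
    , (¬u#v ∷ _ ∷ ¬u#x ∷ []) ∷ (_ ∷ ¬v#x ∷ []) ∷ _ ∷ [] ∷ []
    , enabled) x-enabled =
    ((u≢v ∷ u≢x ∷ []) ∷ (v≢x ∷ []) ∷ [] ∷ []) ,
    ((¬u#v ∷ ¬u#x ∷ []) ∷ (¬v#x ∷ []) ∷ [] ∷ []) ,
    enabled′
    where
    enabled′ : ∀ p y s → u ∷ v ∷ x ∷ [] ≡ p ++ y ∷ s → Lift _ (Enabled p y)
    enabled′ [] _ _ refl = enabled [] _ _ refl
    enabled′ (_ ∷ []) _ _ refl = enabled (_ ∷ []) _ _ refl
    enabled′ (_ ∷ _ ∷ []) _ _ refl = lift x-enabled
    enabled′ (_ ∷ _ ∷ _ ∷ []) _ _ ()
    enabled′ (_ ∷ _ ∷ _ ∷ _ ∷ _) _ _ ()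

module _ {E : Set} (ε : DES E) where
  open DES ε

  bundle-met-in-trace : ∀ p x s → DESTrace ε (p ++ x ∷ s) →
                        ∀ X → X ↦ x → ∃ λ z → X z × z ∈ p
  bundle-met-in-trace p x s (_ , _ , met) = met p x s refl

toFin : Ev → Fin 5
toFin a = zero
toFin b = suc zero
toFin c = suc (suc zero)
toFin d = suc (suc (suc zero))
toFin e = suc (suc (suc (suc zero)))

fromFin : Fin 5 → Ev
fromFin zero = a
fromFin (suc zero) = b
fromFin (suc (suc zero)) = c
fromFin (suc (suc (suc zero))) = d
fromFin (suc (suc (suc (suc zero)))) = e

fromFin-toFin : ∀ x → fromFin (toFin x) ≡ x
fromFin-toFin a = refl
fromFin-toFin b = refl
fromFin-toFin c = refl
fromFin-toFin d = refl
fromFin-toFin e = refl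

toFin-injective : Injective _≡_ _≡_ toFin
toFin-injective {x} {y} toFin-x≡toFin-y = begin
  x                ≡⟨ sym (fromFin-toFin x) ⟩
  fromFin (toFin x) ≡⟨ cong fromFin toFin-x≡toFin-y ⟩
  fromFin (toFin y) ≡⟨ fromFin-toFin y ⟩
  y                ∎
  where open ≡-Reasoning

_≟_ : DecidableEquality Ev
_≟_ = inj⇒≟ (mk↣ toFin-injective)

lowers : List Ev
lowers = a ∷ b ∷ c ∷ d ∷ []

∈lowers⇒Lower : ∀ {x} → x ∈ lowers → Lower x
∈lowers⇒Lower (here refl) = inj₁ refl
∈lowers⇒Lower (there (here refl)) = inj₂ (inj₁ refl)
∈lowers⇒Lower (there (there (here refl))) = inj₂ (inj₂ (inj₁ refl))
∈lowers⇒Lower (there (there (there (here refl)))) = inj₂ (inj₂ (inj₂ refl))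

Lower⇒∈lowers : ∀ {x} → Lower x → x ∈ lowers
Lower⇒∈lowers (inj₁ refl) = here refl
Lower⇒∈lowers (inj₂ (inj₁ refl)) = there (here refl)
Lower⇒∈lowers (inj₂ (inj₂ (inj₁ refl))) = there (there (here refl))
Lower⇒∈lowers (inj₂ (inj₂ (inj₂ refl))) = there (there (there (here refl)))

Lower⇒≢e : ∀ {x} → Lower x → x ≢ e
Lower⇒≢e (inj₁ refl) ()
Lower⇒≢e (inj₂ (inj₁ refl)) ()
Lower⇒≢e (inj₂ (inj₂ (inj₁ refl))) ()
Lower⇒≢e (inj₂ (inj₂ (inj₂ refl))) ()

δ-conflict-free : ∀ t → AllPairs (λ x y → ¬ DES._#_ δ x y) t
δ-conflict-free [] = []
δ-conflict-free (_ ∷ t) = All.universal (λ _ ()) t ∷ δ-conflict-free t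

δ-not-trace : ∀ {x y p} → Lower x → Lower y → x ≢ y → x ∉ p → y ∉ p → ¬ DESTrace δ (p ∷ʳ e)
δ-not-trace {x} {y} {p} x-lower y-lower x≢y x∉p y∉p trace
  with bundle-met-in-trace δ p e [] trace (λ z → z ≡ x ⊎ z ≡ y)
         (lift (refl , x , y , x-lower , y-lower , x≢y , λ _ → id , id))
... | _ , inj₁ refl , x∈p = x∉p x∈p
... | _ , inj₂ refl , y∈p = y∉p y∈p

δ-trace : ∀ {u v w m} → Unique (u ∷ v ∷ w ∷ []) → All Lower (u ∷ v ∷ w ∷ []) →
          (∀ z → Lower z → z ∈ u ∷ v ∷ w ∷ [] ⊎ z ≡ m) → DESTrace δ (u ∷ v ∷ w ∷ e ∷ [])
δ-trace {u} {v} {w} ((u≢v ∷ u≢w ∷ []) ∷ (v≢w ∷ []) ∷ [] ∷ [])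
        (u-lower ∷ v-lower ∷ w-lower ∷ []) covers =
  ( (u≢v ∷ u≢w ∷ Lower⇒≢e u-lower ∷ [])
  ∷ (v≢w ∷ Lower⇒≢e v-lower ∷ [])
  ∷ (Lower⇒≢e w-lower ∷ [])
  ∷ [] ∷ []) ,
  δ-conflict-free _ ,
  bundles-met
  where
  bundles-met : ∀ p x s → u ∷ v ∷ w ∷ e ∷ [] ≡ p ++ x ∷ s →
                ∀ X → DES._↦_ δ X x → ∃ λ z → X z × z ∈ p
  bundles-met [] _ _ refl _ (lift (u≡e , _)) = ⊥-elim (Lower⇒≢e u-lower u≡e)
  bundles-met (_ ∷ []) _ _ refl _ (lift (v≡e , _)) = ⊥-elim (Lower⇒≢e v-lower v≡e)
  bundles-met (_ ∷ _ ∷ []) _ _ refl _ (lift (w≡e , _)) = ⊥-elim (Lower⇒≢e w-lower w≡e)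
  bundles-met (_ ∷ _ ∷ _ ∷ []) _ _ refl X (lift (_ , x , x′ , x-lower , x′-lower , x≢x′ , X≐))
    with covers x x-lower | covers x′ x′-lower
  ... | inj₁ x∈p  | _          = x , proj₂ (X≐ x) (inj₁ refl) , x∈p
  ... | inj₂ _    | inj₁ x′∈p  = x′ , proj₂ (X≐ x′) (inj₂ refl) , x′∈p
  ... | inj₂ x≡m  | inj₂ x′≡m  = ⊥-elim (x≢x′ (trans x≡m (sym x′≡m)))
  bundles-met (_ ∷ _ ∷ _ ∷ _ ∷ []) _ _ ()
  bundles-met (_ ∷ _ ∷ _ ∷ _ ∷ _ ∷ _) _ _ ()

record Split : Set where
  constructor _,_∣_,_
  field
    u v x y : Ev

  pair : List Ev
  pair = u ∷ v ∷ []

  complement : List Ev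
  complement = x ∷ y ∷ []

  members : List Ev
  members = pair ++ complement

open Split

IsSplit : Split → Set
IsSplit s = Unique (members s) × members s ⊆ lowers × lowers ⊆ members s

isSplit? : ∀ s → Dec (IsSplit s)
isSplit? s = unique? _≟_ (members s) ×-dec (members s ⊆? lowers) ×-dec (lowers ⊆? members s)
  where open DecSubset _≟_ using (_⊆?_)

split : Fin 6 → Split
split zero                               = a , b ∣ c , d
split (suc zero)                         = a , c ∣ b , d
split (suc (suc zero))                   = a , d ∣ b , c
split (suc (suc (suc zero)))             = b , c ∣ a , d
split (suc (suc (suc (suc zero))))       = b , d ∣ a , c
split (suc (suc (suc (suc (suc zero))))) = c , d ∣ a , b

split-valid : ∀ i → IsSplit (split i)
split-valid = toWitness {a? = all? (isSplit? ∘ split)} _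

splits-separated : ∀ i j → i ≡ j ⊎ Any (_∈ complement (split j)) (pair (split i))
splits-separated = toWitness {a? = all? λ i → all? λ j →
  (i Fin.≟ j) ⊎-dec any? (_∈? complement (split j)) (pair (split i))} _
  where open DecMembership _≟_ using (_∈?_)

pair-misses-bundle : ∀ {s} → IsSplit s → ¬ DESTrace δ (pair s ∷ʳ e)
pair-misses-bundle {u , v ∣ x , y}
  ((_ ∷ u≢x ∷ u≢y ∷ []) ∷ (v≢x ∷ v≢y ∷ []) ∷ (x≢y ∷ []) ∷ _ , ⊆lowers , _)
  with All.tabulate {xs = u ∷ v ∷ x ∷ y ∷ []} (∈lowers⇒Lower ∘ ⊆lowers)
... | _ ∷ _ ∷ x-lower ∷ y-lower ∷ [] =
  δ-not-trace x-lower y-lower x≢y (outside u≢x v≢x) (outside u≢y v≢y)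
  where
  outside : ∀ {z} → u ≢ z → v ≢ z → z ∉ u ∷ v ∷ []
  outside u≢z _ (here z≡u) = u≢z (sym z≡u)
  outside _ v≢z (there (here z≡v)) = v≢z (sym z≡v)

complement-δ-trace : ∀ {s w} → IsSplit s → w ∈ complement s → DESTrace δ (u s ∷ v s ∷ w ∷ e ∷ [])
complement-δ-trace {u , v ∣ x , y} (distinct , ⊆lowers , ⊇lowers) w∈complement
  with distinct | All.tabulate {xs = u ∷ v ∷ x ∷ y ∷ []} (∈lowers⇒Lower ∘ ⊆lowers) | w∈complement
... | (u≢v ∷ u≢x ∷ _) ∷ (v≢x ∷ _) ∷ _ | u-lower ∷ v-lower ∷ x-lower ∷ _ | here refl =
  δ-trace ((u≢v ∷ u≢x ∷ []) ∷ (v≢x ∷ []) ∷ [] ∷ []) (u-lower ∷ v-lower ∷ x-lower ∷ [])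
    (λ _ → ∈-∷ʳ⁻ (u ∷ v ∷ x ∷ []) ∘ ⊇lowers ∘ Lower⇒∈lowers)
... | (u≢v ∷ _ ∷ u≢y ∷ []) ∷ (_ ∷ v≢y ∷ []) ∷ _ | u-lower ∷ v-lower ∷ _ ∷ y-lower ∷ []
    | there (here refl) =
  δ-trace ((u≢v ∷ u≢y ∷ []) ∷ (v≢y ∷ []) ∷ [] ∷ []) (u-lower ∷ v-lower ∷ y-lower ∷ [])
    (λ _ → ∈-∷ʳ⁻ (u ∷ v ∷ y ∷ []) ∘ ∈-resp-↭ swap-complement ∘ ⊇lowers ∘ Lower⇒∈lowers)
  where
  swap-complement : u ∷ v ∷ x ∷ y ∷ [] ↭ u ∷ v ∷ y ∷ x ∷ []
  swap-complement = ↭-prep u (↭-prep v (↭-swap x y ↭-refl))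

module _ (σ : SES Ev) (same : SameTraces δ σ) where
  open SES σ

  pending-after-pair : ∀ {s} → IsSplit s → ¬ ¬ ∃ (PendingCause σ (pair s) e)
  pending-after-pair valid nothing-pending =
    pair-misses-bundle valid (proj₂ (same _) (skip-unneeded σ
      (proj₁ (same _) (complement-δ-trace valid (here refl)))
      (enabled-if-nothing-pending σ _≟_ λ z pending → nothing-pending (z , pending))))

  pending-resolved-by-complement : ∀ {s w z} → IsSplit s → w ∈ complement s →
                                   PendingCause σ (pair s) e z → ¬ Drop w z e → z ≡ w
  pending-resolved-by-complement {s} {w} valid w∈complement pending =
    pending-resolved σ pending
      (enabled-in-trace σ (pair s ∷ʳ w) e []
        (proj₁ (same _) (complement-δ-trace valid w∈complement)))

  pending-causes-differ : ∀ {s t w z} → IsSplit t → w ∈ pair s → w ∈ complement t →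
                          PendingCause σ (pair s) e z → ¬ PendingCause σ (pair t) e z
  pending-causes-differ {w = w} valid-t w∈pair w∈complement (_ , undropped , z∉pair) pending-t
    with pending-resolved-by-complement valid-t w∈complement pending-t
           (λ drop → undropped (w , w∈pair , drop))
  ... | refl = z∉pair w∈pair

  pending-causes-injective : (cause : ∀ i → ∃ (PendingCause σ (pair (split i)) e)) →
                             Injective _≡_ _≡_ (proj₁ ∘ cause)
  pending-causes-injective cause {i} {j} same-cause with splits-separated i j
  ... | inj₁ i≡j = i≡j
  ... | inj₂ separated with find separated
  ...   | _ , w∈pair , w∈complement =
    ⊥-elim (pending-causes-differ {split i} (split-valid j) w∈pair w∈complement
      (proj₂ (cause i)) (subst (PendingCause σ (pair (split j)) e) (sym same-cause) (proj₂ (cause j))))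

lemmaA3 : ¬ (Σ (SES Ev) λ σ → SameTraces δ σ)
lemmaA3 (σ , same) =
  sequence (RawMonad.rawApplicative ¬¬-Monad) (λ i → pending-after-pair σ same (split-valid i))
    λ cause → <⇒notInjective (n<1+n 5)
      (λ same-fin → pending-causes-injective σ same cause (toFin-injective same-fin))
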